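{- Let $A$ be a graph such that (c1) $A$ is connected, (c2) every vertex of $A$ has degree at most 3, (c3) every vertex of $A$ of degree 2 or 3 belongs to exactly one triangle of $A$, and (c4) $A$ has exactly three vertices of degree 1. Then $A$ has no $\Lambda$-factor.
   Context: Graphs are finite, undirected, simple. A $\Lambda$-factor of a graph $H$ is a spanning subgraph of $H$ every component of which is a 3-vertex path. -}

module Defs where

open import Data.Nat using (ℕ; zero; suc; _+_; _<ᵇ_)
open import Data.Bool using (Bool; true; false; if_then_else_; _∧_)
open import Data.Fin using (Fin; toℕ)
open import Data.Fin.Properties using (_≟_)
open import Data.List using (List; []; _∷_)
open import Data.Product using (Σ; _×_; _,_; ∃)
open import Relation.Nullary.Decidable using (⌊_⌋)
open import Relation.Binary.PropositionalEquality using (_≡_)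

record Graph (n : ℕ) : Set where
  field
    Adj    : Fin n → Fin n → Bool
    sym    : ∀ u v → Adj u v ≡ Adj v u
    irrefl : ∀ v → Adj v v ≡ false
open Graph public

count : ∀ {n} → (Fin n → Bool) → ℕ
count {zero}  p = 0
count {suc n} p = (if p Fin.zero then 1 else 0) + count {n} (λ i → p (Fin.suc i))
  where import Data.Fin as Fin

deg : ∀ {n} → Graph n → Fin n → ℕ
deg G v = count (Adj G v)

sumFin : ∀ {n} → (Fin n → ℕ) → ℕ
sumFin {zero}  f = 0
sumFin {suc n} f = f Fin.zero + sumFin (λ i → f (Fin.suc i))
  where import Data.Fin as Fin

-- number of triangles of G containing v: unordered pairs {u,w} (u < w)
-- with v,u,w pairwise adjacent
trianglesAt : ∀ {n} → Graph n → Fin n → ℕ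
trianglesAt G v =
  sumFin (λ u → count (λ w → (toℕ u <ᵇ toℕ w) ∧ (Adj G v u ∧ (Adj G v w ∧ Adj G u w))))

data Walk {n} (G : Graph n) : Fin n → Fin n → Set where
  here : ∀ {v} → Walk G v v
  step : ∀ {u v w} → Adj G u v ≡ true → Walk G v w → Walk G u w

Connected : ∀ {n} → Graph n → Set
Connected G = ∀ u v → Walk G u v

-- Λ-factor: a family of 3-vertex paths a - b - c in G (edges ab, bc)
-- whose vertex sets partition V(G): every vertex occurs exactly once
-- among all entries of all triples (this forces a,b,c distinct).
Path3 : ∀ {n} → Graph n → Set
Path3 {n} G = Σ (Fin n × Fin n × Fin n) λ { (a , b , c) → (Adj G a b ≡ true) × (Adj G b c ≡ true) }

occ : ∀ {n} {G : Graph n} → Fin n → Path3 G → ℕ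
occ v ((a , b , c) , _) = (if ⌊ a ≟ v ⌋ then 1 else 0) + ((if ⌊ b ≟ v ⌋ then 1 else 0) + (if ⌊ c ≟ v ⌋ then 1 else 0))

occs : ∀ {n} {G : Graph n} → Fin n → List (Path3 G) → ℕ
occs v []       = 0
occs {G = G} v (p ∷ ps) = occ {G = G} v p + occs {G = G} v ps

HasΛFactor : ∀ {n} → Graph n → Set
HasΛFactor G = ∃ λ (ps : List (Path3 G)) → ∀ v → occs {G = G} v ps ≡ 1

isOne : ℕ → Bool
isOne (suc zero) = true
isOne _          = false

module Submission where

-- Fix a Λ-factor. Let offDegree v be the number of factor edges at v that lie on no
-- triangle, and charge v the number of such edges on the path whose middle vertex is v
-- (0 if v is an endpoint), so that Σ offDegree = 2 Σ charge. A leaf is an endpoint of its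
-- path whose edge lies on no triangle: offDegree 1, charge 0. Every other vertex lies on
-- exactly one triangle T, and 2 charge(T) ≤ offDegree(T): at most one corner of T is
-- charged, with charge and offDegree 1, and then another corner lies outside that corner's
-- path and ends its own path with an edge off every triangle. Summing over the triangles
-- gives 2 Σ charge ≤ Σ offDegree − #leaves, so there are no leaves.

open import Defs hiding (sym)

open import Algebra.Properties.CommutativeSemigroup using (interchange; x∙yz≈y∙xz)
open import Data.Bool using (Bool; true; false; if_then_else_; _∧_; not)
import Data.Bool.Properties as Bool
open import Data.Empty using (⊥; ⊥-elim)
open import Data.Fin as Fin using (Fin; toℕ)
open import Data.Fin.Properties using (_≟_; <-cmp; any?)
open import Data.List using (List; []; _∷_; length; map)
open import Data.List.Membership.Propositional using (_∈_)
open import Data.List.Properties using (map-cong)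
open import Data.List.Relation.Unary.All using (All; []; _∷_)
open import Data.List.Relation.Unary.AllPairs using ([]; _∷_)
open import Data.List.Relation.Unary.Any using (here; there)
open import Data.List.Relation.Unary.Unique.Propositional using (Unique)
import Data.Nat as ℕ
open import Data.Nat using (ℕ; zero; suc; _+_; _≤_; _<_; z≤n; s≤s; _<ᵇ_)
open import Data.Nat.ListAction using (sum)
open import Data.Nat.Properties
  using ( module ≤-Reasoning; ≤-refl; ≤-trans; ≤-reflexive; <-irrefl; <⇒<ᵇ; 1+n≢0; n≤0⇒n≡0; n>0⇒n≢0; n≢0⇒n>0
        ; +-comm; +-assoc; +-identityʳ; +-commutativeSemigroup; +-mono-≤; +-monoˡ-≤; +-cancelˡ-≤
        ; m≤m+n; m≤n+m; m+n≡0⇒m≡0; m+n≡0⇒n≡0 )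
open import Data.Nat.Tactic.RingSolver using (solve-∀)
open import Data.Product using (_×_; _,_; ∃; ∃₂; proj₁; proj₂)
open import Data.Sum using (_⊎_; inj₁; inj₂)
open import Function using (Equivalence; mk⇔)
open import Relation.Binary using (tri<; tri≈; tri>)
open import Relation.Binary.PropositionalEquality
open import Relation.Nullary using (¬_; Dec; yes; no; does; _×-dec_)
open import Relation.Nullary.Decidable using (⌊_⌋; dec-true; dec-false; does-⇔)

infix 7 _when_
_when_ : ℕ → Bool → ℕ
k when b = if b then k else 0

≟-refl : ∀ {n} (a : Fin n) → ⌊ a ≟ a ⌋ ≡ true
≟-refl a with a ≟ a
... | yes _   = refl
... | no a≢a = ⊥-elim (a≢a refl)

≟-≢ : ∀ {n} {a b : Fin n} → a ≢ b → ⌊ a ≟ b ⌋ ≡ false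
≟-≢ {a = a} {b} a≢b with a ≟ b
... | yes a≡b = ⊥-elim (a≢b a≡b)
... | no _    = refl

sumFin-cong : ∀ {n} {f g : Fin n → ℕ} → (∀ i → f i ≡ g i) → sumFin f ≡ sumFin g
sumFin-cong {zero}  f≗g = refl
sumFin-cong {suc n} f≗g = cong₂ _+_ (f≗g Fin.zero) (sumFin-cong (λ i → f≗g (Fin.suc i)))

sumFin-mono : ∀ {n} {f g : Fin n → ℕ} → (∀ i → f i ≤ g i) → sumFin f ≤ sumFin g
sumFin-mono {zero}  f≤g = z≤n
sumFin-mono {suc n} f≤g = +-mono-≤ (f≤g Fin.zero) (sumFin-mono (λ i → f≤g (Fin.suc i)))

sumFin-zero : ∀ n → sumFin {n} (λ _ → 0) ≡ 0
sumFin-zero zero    = refl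
sumFin-zero (suc n) = sumFin-zero n

sumFin-+ : ∀ {n} (f g : Fin n → ℕ) → sumFin (λ i → f i + g i) ≡ sumFin f + sumFin g
sumFin-+ {zero}  f g = refl
sumFin-+ {suc n} f g = begin
  f Fin.zero + g Fin.zero + sumFin (λ i → f (Fin.suc i) + g (Fin.suc i))
    ≡⟨ cong (f Fin.zero + g Fin.zero +_) (sumFin-+ (λ i → f (Fin.suc i)) (λ i → g (Fin.suc i))) ⟩
  f Fin.zero + g Fin.zero + (sumFin (λ i → f (Fin.suc i)) + sumFin (λ i → g (Fin.suc i)))
    ≡⟨ interchange +-commutativeSemigroup (f Fin.zero) (g Fin.zero) _ _ ⟩
  sumFin f + sumFin g ∎
  where open ≡-Reasoning

sumFin-swap : ∀ {n m} (f : Fin n → Fin m → ℕ) →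
  sumFin (λ i → sumFin (f i)) ≡ sumFin (λ j → sumFin (λ i → f i j))
sumFin-swap {zero}  {m} f = sym (sumFin-zero m)
sumFin-swap {suc n} {m} f = trans (cong (sumFin (f Fin.zero) +_) (sumFin-swap (λ i → f (Fin.suc i))))
  (sym (sumFin-+ (f Fin.zero) (λ j → sumFin (λ i → f (Fin.suc i) j))))

sumFin-point : ∀ {n} (a : Fin n) k → sumFin (λ x → k when ⌊ a ≟ x ⌋) ≡ k
sumFin-point {suc n} Fin.zero    k = trans (cong (k +_) (sumFin-zero n)) (+-identityʳ k)
sumFin-point {suc n} (Fin.suc a) k = trans (sumFin-cong (λ x → cong (k when_) (suc-≟ x))) (sumFin-point a k)
  where
  suc-≟ : ∀ x → ⌊ Fin.suc a ≟ Fin.suc x ⌋ ≡ ⌊ a ≟ x ⌋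
  suc-≟ x with a ≟ x
  ... | yes _ = refl
  ... | no _  = refl

sumFin-pair : ∀ {n} {p : Fin n → Bool} {u w : Fin n} (f : Fin n → ℕ) → u ≢ w →
  p u ≡ true → p w ≡ true → (∀ x → p x ≡ true → x ≡ u ⊎ x ≡ w) →
  sumFin (λ x → f x when p x) ≡ f u + f w
sumFin-pair {p = p} {u} {w} f u≢w pu pw p⇒ = begin
  sumFin (λ x → f x when p x)
    ≡⟨ sumFin-cong split ⟩
  sumFin (λ x → f u when ⌊ u ≟ x ⌋ + f w when ⌊ w ≟ x ⌋)
    ≡⟨ sumFin-+ (λ x → f u when ⌊ u ≟ x ⌋) (λ x → f w when ⌊ w ≟ x ⌋) ⟩
  sumFin (λ x → f u when ⌊ u ≟ x ⌋) + sumFin (λ x → f w when ⌊ w ≟ x ⌋)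
    ≡⟨ cong₂ _+_ (sumFin-point u (f u)) (sumFin-point w (f w)) ⟩
  f u + f w ∎
  where
  open ≡-Reasoning
  split : ∀ x → f x when p x ≡ f u when ⌊ u ≟ x ⌋ + f w when ⌊ w ≟ x ⌋
  split x with u ≟ x | w ≟ x
  ... | yes refl | yes refl = ⊥-elim (u≢w refl)
  ... | yes refl | no _     rewrite pu = sym (+-identityʳ (f x))
  ... | no _     | yes refl rewrite pw = refl
  ... | no x≢u   | no x≢w   with p x in px
  ...   | false = refl
  ...   | true with p⇒ x px
  ...     | inj₁ x≡u = ⊥-elim (x≢u (sym x≡u))
  ...     | inj₂ x≡w = ⊥-elim (x≢w (sym x≡w))

sumFin-none : ∀ {n} {p : Fin n → Bool} (f : Fin n → ℕ) → (∀ x → p x ≡ false) →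
  sumFin (λ x → f x when p x) ≡ 0
sumFin-none {n} {p} f ¬p = trans (sumFin-cong (λ x → cong (f x when_) (¬p x))) (sumFin-zero n)

term≤sumFin : ∀ {n} (f : Fin n → ℕ) a → f a ≤ sumFin f
term≤sumFin f a = begin
  f a                                 ≡⟨ sumFin-point a (f a) ⟨
  sumFin (λ x → f a when ⌊ a ≟ x ⌋)  ≤⟨ sumFin-mono bound ⟩
  sumFin f                            ∎
  where
  open ≤-Reasoning
  bound : ∀ x → f a when ⌊ a ≟ x ⌋ ≤ f x
  bound x with a ≟ x
  ... | yes refl = ≤-refl
  ... | no _     = z≤n

term+term≤sumFin : ∀ {n} (f : Fin n → ℕ) {a b} → a ≢ b → f a + f b ≤ sumFin f
term+term≤sumFin f {a} {b} a≢b = begin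
  f a + f b
    ≡⟨ cong₂ _+_ (sumFin-point a (f a)) (sumFin-point b (f b)) ⟨
  sumFin (λ x → f a when ⌊ a ≟ x ⌋) + sumFin (λ x → f b when ⌊ b ≟ x ⌋)
    ≡⟨ sumFin-+ (λ x → f a when ⌊ a ≟ x ⌋) (λ x → f b when ⌊ b ≟ x ⌋) ⟨
  sumFin (λ x → f a when ⌊ a ≟ x ⌋ + f b when ⌊ b ≟ x ⌋)
    ≤⟨ sumFin-mono bound ⟩
  sumFin f ∎
  where
  open ≤-Reasoning
  bound : ∀ x → f a when ⌊ a ≟ x ⌋ + f b when ⌊ b ≟ x ⌋ ≤ f x
  bound x with a ≟ x | b ≟ x
  ... | yes refl | yes refl = ⊥-elim (a≢b refl)
  ... | yes refl | no _     = ≤-reflexive (+-identityʳ (f x))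
  ... | no _     | yes refl = ≤-refl
  ... | no _     | no _     = z≤n

sumFin-positive : ∀ {n} (f : Fin n → ℕ) → 0 < sumFin f → ∃ λ a → 0 < f a
sumFin-positive {suc n} f pos with f Fin.zero in f0
... | suc _ = Fin.zero , subst (0 <_) (sym f0) (s≤s z≤n)
... | zero with sumFin-positive (λ i → f (Fin.suc i)) pos
...   | a , fa>0 = Fin.suc a , fa>0

count≡sumFin : ∀ {n} (p : Fin n → Bool) → count p ≡ sumFin (λ x → 1 when p x)
count≡sumFin {zero}  p = refl
count≡sumFin {suc n} p = cong (1 when p Fin.zero +_) (count≡sumFin (λ i → p (Fin.suc i)))

count-positive : ∀ {n} (p : Fin n → Bool) → 0 < count p → ∃ λ a → p a ≡ true
count-positive p pos with sumFin-positive (λ x → 1 when p x) (subst (0 <_) (count≡sumFin p) pos)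
... | a , pa>0 with p a in pa
...   | true = a , pa

count-remove : ∀ {n} (p : Fin n → Bool) {a} → p a ≡ true →
  count p ≡ suc (count (λ x → p x ∧ not ⌊ a ≟ x ⌋))
count-remove p {a} pa = begin
  count p                                  ≡⟨ count≡sumFin p ⟩
  sumFin (λ x → 1 when p x)                ≡⟨ sumFin-cong split ⟩
  sumFin (λ x → 1 when ⌊ a ≟ x ⌋ + 1 when p′ x)
    ≡⟨ sumFin-+ (λ x → 1 when ⌊ a ≟ x ⌋) (λ x → 1 when p′ x) ⟩
  sumFin (λ x → 1 when ⌊ a ≟ x ⌋) + sumFin (λ x → 1 when p′ x)
    ≡⟨ cong₂ _+_ (sumFin-point a 1) (sym (count≡sumFin p′)) ⟩
  suc (count p′) ∎
  where
  open ≡-Reasoning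
  p′ : Fin _ → Bool
  p′ x = p x ∧ not ⌊ a ≟ x ⌋
  split : ∀ x → 1 when p x ≡ 1 when ⌊ a ≟ x ⌋ + 1 when p′ x
  split x with a ≟ x
  ... | yes refl rewrite pa = refl
  ... | no _ with p x
  ...   | true  = refl
  ...   | false = refl

length≤count : ∀ {n} (p : Fin n → Bool) {xs : List (Fin n)} →
  Unique xs → All (λ x → p x ≡ true) xs → length xs ≤ count p
length≤count p []              []        = z≤n
length≤count p {x ∷ xs} (x≢xs ∷ uniq) (px ∷ pxs) =
  subst (suc (length xs) ≤_) (sym (count-remove p px)) (s≤s (length≤count _ uniq (kept x≢xs pxs)))
  where
  kept : ∀ {x ys} → All (x ≢_) ys → All (λ y → p y ≡ true) ys →
    All (λ y → (p y ∧ not ⌊ x ≟ y ⌋) ≡ true) ys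
  kept []              []         = []
  kept (x≢y ∷ x≢ys) (py ∷ pys) = cong₂ (λ b c → b ∧ not c) py (≟-≢ x≢y) ∷ kept x≢ys pys

m+n≡1∧0<m⇒n≡0 : ∀ m {n} → m + n ≡ 1 → 0 < m → n ≡ 0
m+n≡1∧0<m⇒n≡0 (suc zero)    refl _ = refl
m+n≡1∧0<m⇒n≡0 (suc (suc m)) ()   _

m+n≡1∧0<n⇒m≡0∧n≡1 : ∀ m {n} → m + n ≡ 1 → 0 < n → m ≡ 0 × n ≡ 1
m+n≡1∧0<n⇒m≡0∧n≡1 zero          m+n≡1 _  = refl , m+n≡1
m+n≡1∧0<n⇒m≡0∧n≡1 (suc zero)    {suc n} () _
m+n≡1∧0<n⇒m≡0∧n≡1 (suc (suc m)) ()      _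

does⇒witness : ∀ {a} {A : Set a} (a? : Dec A) → does a? ≡ true → A
does⇒witness (yes a) _ = a

2≰1 : ¬ 2 ≤ 1
2≰1 (s≤s ())

leaf-count-arith : ∀ m s l → s + (l + l) ≡ (m + m) + (m + m) →
  (m + (m + m)) + (m + (m + m)) ≤ (m + m) + s → l ≡ 0
leaf-count-arith m s l leaves balance = m+n≡0⇒m≡0 l (n≤0⇒n≡0 (+-cancelˡ-≤ (six m) (l + l) 0 bound))
  where
  six : ℕ → ℕ
  six m = (m + (m + m)) + (m + (m + m))
  bound : six m + (l + l) ≤ six m + 0
  bound = begin
    six m + (l + l)           ≤⟨ +-monoˡ-≤ (l + l) balance ⟩
    (m + m) + s + (l + l)     ≡⟨ +-assoc (m + m) s (l + l) ⟩
    (m + m) + (s + (l + l))   ≡⟨ cong ((m + m) +_) leaves ⟩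
    (m + m) + ((m + m) + (m + m)) ≡⟨ regroup m ⟩
    six m + 0                 ∎
    where
    open ≤-Reasoning
    regroup : ∀ m → (m + m) + ((m + m) + (m + m)) ≡ ((m + (m + m)) + (m + (m + m))) + 0
    regroup = solve-∀

module _ {a} {A : Set a} where

  sum-map-cong : ∀ {f g : A → ℕ} xs → (∀ x → f x ≡ g x) → sum (map f xs) ≡ sum (map g xs)
  sum-map-cong xs f≗g = cong sum (map-cong f≗g xs)

  sum-map-+ : ∀ (f g : A → ℕ) xs → sum (map (λ x → f x + g x) xs) ≡ sum (map f xs) + sum (map g xs)
  sum-map-+ f g []       = refl
  sum-map-+ f g (x ∷ xs) = trans (cong (f x + g x +_) (sum-map-+ f g xs))
    (interchange +-commutativeSemigroup (f x) (g x) _ _)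

  sumFin-sum-map : ∀ {n} (L : Fin n → A → ℕ) xs →
    sumFin (λ i → sum (map (L i) xs)) ≡ sum (map (λ x → sumFin (λ i → L i x)) xs)
  sumFin-sum-map {n} L []       = sumFin-zero n
  sumFin-sum-map     L (x ∷ xs) = trans (sumFin-+ (λ i → L i x) (λ i → sum (map (L i) xs)))
    (cong (sumFin (λ i → L i x) +_) (sumFin-sum-map L xs))

  term≤sum-map : ∀ (g : A → ℕ) {x xs} → x ∈ xs → g x ≤ sum (map g xs)
  term≤sum-map g {xs = y ∷ ys} (here refl) = m≤m+n (g y) (sum (map g ys))
  term≤sum-map g {xs = y ∷ ys} (there x∈) = ≤-trans (term≤sum-map g x∈) (m≤n+m _ (g y))

  sum-map≡0 : ∀ {g f : A → ℕ} → (∀ y → g y ≡ 0 → f y ≡ 0) →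
    ∀ xs → sum (map g xs) ≡ 0 → sum (map f xs) ≡ 0
  sum-map≡0 g0⇒f0 []       _  = refl
  sum-map≡0 {g} g0⇒f0 (x ∷ xs) Σ≡0 =
    cong₂ _+_ (g0⇒f0 x (m+n≡0⇒m≡0 (g x) Σ≡0)) (sum-map≡0 g0⇒f0 xs (m+n≡0⇒n≡0 (g x) Σ≡0))

  module _ {g : A → ℕ} where

    sum-map≡1-witness : ∀ {xs} → sum (map g xs) ≡ 1 → ∃ λ x → x ∈ xs × 0 < g x
    sum-map≡1-witness {x ∷ xs} Σ≡1 with g x in gx
    ... | suc _ = x , here refl , subst (0 <_) (sym gx) (s≤s z≤n)
    ... | zero with sum-map≡1-witness {xs} Σ≡1
    ...   | y , y∈ , gy>0 = y , there y∈ , gy>0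

    private
      head-only : ∀ {x} xs → sum (map g (x ∷ xs)) ≡ 1 → 0 < g x → sum (map g xs) ≡ 0
      head-only {x} _ Σ≡1 gx>0 = m+n≡1∧0<m⇒n≡0 (g x) Σ≡1 gx>0

      tail-only : ∀ {x} xs {y} → sum (map g (x ∷ xs)) ≡ 1 → y ∈ xs → 0 < g y →
        g x ≡ 0 × sum (map g xs) ≡ 1
      tail-only {x} xs Σ≡1 y∈ gy>0 =
        m+n≡1∧0<n⇒m≡0∧n≡1 (g x) Σ≡1 (≤-trans gy>0 (term≤sum-map g y∈))

      positive-in-null : ∀ {y} xs → sum (map g xs) ≡ 0 → y ∈ xs → 0 < g y → ⊥
      positive-in-null _ Σ≡0 y∈ gy>0 =
        <-irrefl refl (≤-trans (≤-trans gy>0 (term≤sum-map g y∈)) (≤-reflexive Σ≡0))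

    sum-map≡1-unique : ∀ {xs x y} → sum (map g xs) ≡ 1 →
      x ∈ xs → y ∈ xs → 0 < g x → 0 < g y → x ≡ y
    sum-map≡1-unique Σ≡1 (here refl) (here refl) _ _ = refl
    sum-map≡1-unique {_ ∷ xs} Σ≡1 (here refl) (there y∈) gx>0 gy>0 =
      ⊥-elim (positive-in-null xs (head-only xs Σ≡1 gx>0) y∈ gy>0)
    sum-map≡1-unique {_ ∷ xs} Σ≡1 (there x∈) (here refl) gx>0 gy>0 =
      ⊥-elim (positive-in-null xs (head-only xs Σ≡1 gy>0) x∈ gx>0)
    sum-map≡1-unique {_ ∷ xs} Σ≡1 (there x∈) (there y∈) gx>0 gy>0 =
      sum-map≡1-unique (proj₂ (tail-only xs Σ≡1 x∈ gx>0)) x∈ y∈ gx>0 gy>0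

    sum-map≡1-select : ∀ {f : A → ℕ} → (∀ y → g y ≡ 0 → f y ≡ 0) →
      ∀ {xs x} → sum (map g xs) ≡ 1 → x ∈ xs → 0 < g x → sum (map f xs) ≡ f x
    sum-map≡1-select {f} g0⇒f0 {x ∷ xs} Σ≡1 (here refl) gx>0 =
      trans (cong (f x +_) (sum-map≡0 g0⇒f0 xs (head-only xs Σ≡1 gx>0))) (+-identityʳ (f x))
    sum-map≡1-select {f} g0⇒f0 {y ∷ xs} Σ≡1 (there x∈) gx>0 =
      let (gy≡0 , rest) = tail-only xs Σ≡1 x∈ gx>0
      in trans (cong (_+ sum (map f xs)) (g0⇒f0 y gy≡0)) (sum-map≡1-select g0⇒f0 rest x∈ gx>0)

module Triangles {n : ℕ} (G : Graph n) where

  Edge : Fin n → Fin n → Set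
  Edge x y = Adj G x y ≡ true

  edge? : ∀ x y → Dec (Edge x y)
  edge? x y = Adj G x y Bool.≟ true

  edge-sym : ∀ {x y} → Edge x y → Edge y x
  edge-sym {x} {y} = trans (Graph.sym G y x)

  edge⇒≢ : ∀ {x y} → Edge x y → x ≢ y
  edge⇒≢ {x} xx refl with trans (sym xx) (irrefl G x)
  ... | ()

  distinct-neighbours≤deg : ∀ {v xs} → Unique xs → All (Edge v) xs → length xs ≤ deg G v
  distinct-neighbours≤deg {v} = length≤count (Adj G v)

  Triangle : Fin n → Fin n → Fin n → Set
  Triangle v u w = Edge v u × Edge v w × Edge u w

  triangle? : ∀ v u w → Dec (Triangle v u w)
  triangle? v u w = edge? v u ×-dec edge? v w ×-dec edge? u w

  triangle-swap : ∀ {v u w} → Triangle v u w → Triangle v w u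
  triangle-swap (vu , vw , uw) = vw , vu , edge-sym uw

  triangle-rotate : ∀ {v u w} → Triangle v u w → Triangle u v w
  triangle-rotate (vu , vw , uw) = edge-sym vu , uw , vw

  triangle⇒2≤deg : ∀ {v u w} → Triangle v u w → 2 ≤ deg G v
  triangle⇒2≤deg (vu , vw , uw) = distinct-neighbours≤deg ((edge⇒≢ uw ∷ []) ∷ [] ∷ []) (vu ∷ vw ∷ [])

  UniqueTriangleAt : Fin n → Set
  UniqueTriangleAt v = ∀ {u w u′ w′} → Triangle v u w → Triangle v u′ w′ → u′ ≡ u ⊎ u′ ≡ w

  -- trianglesAt G v is sumFin λ u → count (sortedTriangle v u), definitionally.
  sortedTriangle : Fin n → Fin n → Fin n → Bool
  sortedTriangle v u w = (toℕ u <ᵇ toℕ w) ∧ (Adj G v u ∧ (Adj G v w ∧ Adj G u w))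

  sortedTriangle⇒triangle : ∀ {v u w} → sortedTriangle v u w ≡ true → Triangle v u w
  sortedTriangle⇒triangle {v} {u} {w} sorted with toℕ u <ᵇ toℕ w | Adj G v u | Adj G v w | Adj G u w
  ... | true | true | true | true = refl , refl , refl

  triangle⇒sortedTriangle : ∀ {v u w} → toℕ u < toℕ w → Triangle v u w → sortedTriangle v u w ≡ true
  triangle⇒sortedTriangle u<w (vu , vw , uw) rewrite Equivalence.to Bool.T-≡ (<⇒<ᵇ u<w) | vu | vw | uw = refl

  sort-triangle : ∀ {v u w} → Triangle v u w →
    ∃₂ λ a b → sortedTriangle v a b ≡ true × (a ≡ u × b ≡ w ⊎ a ≡ w × b ≡ u)
  sort-triangle {v} {u} {w} t with <-cmp u w
  ... | tri< u<w _ _ = u , w , triangle⇒sortedTriangle u<w t , inj₁ (refl , refl)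
  ... | tri≈ _ u≡w _ = ⊥-elim (edge⇒≢ (proj₂ (proj₂ t)) u≡w)
  ... | tri> _ _ w<u = w , u , triangle⇒sortedTriangle w<u (triangle-swap t) , inj₂ (refl , refl)

  trianglesAt-positive : ∀ {v} → 0 < trianglesAt G v → ∃₂ (Triangle v)
  trianglesAt-positive {v} pos with sumFin-positive (λ a → count (sortedTriangle v a)) pos
  ... | a , count>0 with count-positive (sortedTriangle v a) count>0
  ...   | b , sorted = a , b , sortedTriangle⇒triangle sorted

  two-sortedTriangles⇒2≤trianglesAt : ∀ {v} a b a′ b′ →
    sortedTriangle v a b ≡ true → sortedTriangle v a′ b′ ≡ true → a ≢ a′ ⊎ b ≢ b′ →
    2 ≤ trianglesAt G v
  two-sortedTriangles⇒2≤trianglesAt {v} a b a′ b′ s s′ differ with a ≟ a′ | differ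
  ... | no a≢a′ | _ = ≤-trans
    (+-mono-≤ (length≤count (sortedTriangle v a) {b ∷ []} ([] ∷ []) (s ∷ []))
              (length≤count (sortedTriangle v a′) {b′ ∷ []} ([] ∷ []) (s′ ∷ [])))
    (term+term≤sumFin (λ x → count (sortedTriangle v x)) a≢a′)
  ... | yes refl | inj₁ a≢a = ⊥-elim (a≢a refl)
  ... | yes refl | inj₂ b≢b′ = ≤-trans
    (length≤count (sortedTriangle v a) {b ∷ b′ ∷ []} ((b≢b′ ∷ []) ∷ [] ∷ []) (s ∷ s′ ∷ []))
    (term≤sumFin (λ x → count (sortedTriangle v x)) a)

  trianglesAt≡1⇒sorted-unique : ∀ {v} a b a′ b′ → trianglesAt G v ≡ 1 →
    sortedTriangle v a b ≡ true → sortedTriangle v a′ b′ ≡ true → a ≡ a′ × b ≡ b′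
  trianglesAt≡1⇒sorted-unique a b a′ b′ one s s′ with a ≟ a′ | b ≟ b′
  ... | yes a≡a′ | yes b≡b′ = a≡a′ , b≡b′
  ... | no a≢a′  | _        =
    ⊥-elim (2≰1 (subst (2 ≤_) one (two-sortedTriangles⇒2≤trianglesAt a b a′ b′ s s′ (inj₁ a≢a′))))
  ... | _        | no b≢b′  =
    ⊥-elim (2≰1 (subst (2 ≤_) one (two-sortedTriangles⇒2≤trianglesAt a b a′ b′ s s′ (inj₂ b≢b′))))

  trianglesAt≡1⇒unique : ∀ {v} → trianglesAt G v ≡ 1 → UniqueTriangleAt v
  trianglesAt≡1⇒unique one t t′ with sort-triangle t | sort-triangle t′
  ... | a , b , s , ab | a′ , b′ , s′ , ab′ with trianglesAt≡1⇒sorted-unique a b a′ b′ one s s′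
  ...   | refl , refl = pair⊆ ab (first∈ ab′)
    where
    first∈ : ∀ {a b u w : Fin n} → a ≡ u × b ≡ w ⊎ a ≡ w × b ≡ u → u ≡ a ⊎ u ≡ b
    first∈ (inj₁ (refl , _)) = inj₁ refl
    first∈ (inj₂ (_ , refl)) = inj₂ refl
    pair⊆ : ∀ {a b u w z : Fin n} → a ≡ u × b ≡ w ⊎ a ≡ w × b ≡ u → z ≡ a ⊎ z ≡ b → z ≡ u ⊎ z ≡ w
    pair⊆ (inj₁ (refl , _)) (inj₁ refl) = inj₁ refl
    pair⊆ (inj₁ (_ , refl)) (inj₂ refl) = inj₂ refl
    pair⊆ (inj₂ (refl , _)) (inj₁ refl) = inj₂ refl
    pair⊆ (inj₂ (_ , refl)) (inj₂ refl) = inj₁ refl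

  CommonNeighbour : Fin n → Fin n → Set
  CommonNeighbour x y = ∃ λ z → Edge x z × Edge y z

  commonNeighbour? : ∀ x y → Dec (CommonNeighbour x y)
  commonNeighbour? x y = any? (λ z → edge? x z ×-dec edge? y z)

  offTriangle : Fin n → Fin n → ℕ
  offTriangle x y = if does (commonNeighbour? x y) then 0 else 1

  offTriangle-¬common : ∀ {x y} → ¬ CommonNeighbour x y → offTriangle x y ≡ 1
  offTriangle-¬common {x} {y} ¬c rewrite dec-false (commonNeighbour? x y) ¬c = refl

  offTriangle-sym : ∀ x y → offTriangle x y ≡ offTriangle y x
  offTriangle-sym x y = cong (λ b → if b then 0 else 1)
    (does-⇔ (mk⇔ flip flip) (commonNeighbour? x y) (commonNeighbour? y x))
    where
    flip : ∀ {x y} → CommonNeighbour x y → CommonNeighbour y x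
    flip (z , xz , yz) = z , yz , xz

  leaf⇒offTriangle≡1 : ∀ {x y} → deg G x ≡ 1 → Edge x y → offTriangle x y ≡ 1
  leaf⇒offTriangle≡1 leaf xy = offTriangle-¬common λ (z , xz , yz) →
    2≰1 (subst (2 ≤_) leaf (distinct-neighbours≤deg ((edge⇒≢ yz ∷ []) ∷ [] ∷ []) (xy ∷ xz ∷ [])))

  TriangleMate : Fin n → Fin n → Set
  TriangleMate v x = ∃ (Triangle v x)

  triangleMate? : ∀ v x → Dec (TriangleMate v x)
  triangleMate? v x = any? (triangle? v x)

  mate : Fin n → Fin n → Bool
  mate v x = does (triangleMate? v x)

  mate-sym : ∀ v x → mate v x ≡ mate x v
  mate-sym v x = does-⇔ (mk⇔ rotate rotate) (triangleMate? v x) (triangleMate? x v)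
    where
    rotate : ∀ {v x} → TriangleMate v x → TriangleMate x v
    rotate (w , t) = w , triangle-rotate t

  leaf⇒¬mate : ∀ {v} x → deg G v ≡ 1 → mate v x ≡ false
  leaf⇒¬mate {v} x leaf =
    dec-false (triangleMate? v x) λ (w , t) → 2≰1 (subst (2 ≤_) leaf (triangle⇒2≤deg t))

  mates-of-triangle : ∀ {v u w} → UniqueTriangleAt v → Triangle v u w → (f : Fin n → ℕ) →
    sumFin (λ x → f x when mate v x) ≡ f u + f w
  mates-of-triangle {v} {u} {w} unique t f = sumFin-pair f (edge⇒≢ (proj₂ (proj₂ t)))
    (dec-true (triangleMate? v u) (w , t)) (dec-true (triangleMate? v w) (u , triangle-swap t))
    (λ x mate-vx → unique t (proj₂ (does⇒witness (triangleMate? v x) mate-vx)))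

module Factor {n : ℕ} (G : Graph n)
  (ps : List (Path3 G)) (factor : ∀ v → occs {G = G} v ps ≡ 1) where
  open Triangles G

  Path : Set
  Path = Path3 G

  start middle end : Path → Fin n
  start  p = proj₁ (proj₁ p)
  middle p = proj₁ (proj₂ (proj₁ p))
  end    p = proj₂ (proj₂ (proj₁ p))

  start-edge : ∀ p → Edge (start p) (middle p)
  start-edge p = proj₁ (proj₂ p)

  end-edge : ∀ p → Edge (middle p) (end p)
  end-edge p = proj₂ (proj₂ p)

  infix 4 _∈ₚ_
  _∈ₚ_ : Fin n → Path → Set
  v ∈ₚ p = 0 < occ {G = G} v p

  spread : (α β γ : Path → ℕ) → Fin n → Path → ℕ
  spread α β γ v p =
    α p when ⌊ start p ≟ v ⌋ + (β p when ⌊ middle p ≟ v ⌋ + γ p when ⌊ end p ≟ v ⌋)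

  ∈ₚ-cases : ∀ {v} p → v ∈ₚ p → start p ≡ v ⊎ middle p ≡ v ⊎ end p ≡ v
  ∈ₚ-cases {v} p v∈p with start p ≟ v | middle p ≟ v | end p ≟ v
  ... | yes s≡v | _       | _       = inj₁ s≡v
  ... | no _    | yes m≡v | _       = inj₂ (inj₁ m≡v)
  ... | no _    | no _    | yes e≡v = inj₂ (inj₂ e≡v)
  ... | no _    | no _    | no _    with v∈p
  ...   | ()

  start∈ₚ : ∀ p → start p ∈ₚ p
  start∈ₚ p rewrite ≟-refl (start p) = s≤s z≤n

  middle∈ₚ : ∀ p → middle p ∈ₚ p
  middle∈ₚ p rewrite ≟-refl (middle p) =
    ≤-trans (s≤s z≤n) (m≤n+m (suc (1 when ⌊ end p ≟ middle p ⌋)) (1 when ⌊ start p ≟ middle p ⌋))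

  end∈ₚ : ∀ p → end p ∈ₚ p
  end∈ₚ p rewrite ≟-refl (end p) =
    ≤-trans (m≤n+m 1 (1 when ⌊ middle p ≟ end p ⌋)) (m≤n+m _ (1 when ⌊ start p ≟ end p ⌋))

  spread-outside : ∀ α β γ {v} p → occ {G = G} v p ≡ 0 → spread α β γ v p ≡ 0
  spread-outside α β γ {v} p v∉p with start p ≟ v | middle p ≟ v | end p ≟ v | v∉p
  ... | no _ | no _ | no _ | _ = refl

  sumFin-spread : ∀ α β γ p → sumFin (λ v → spread α β γ v p) ≡ α p + (β p + γ p)
  sumFin-spread α β γ p = begin
    sumFin (λ v → at-start v + (at-middle v + at-end v))
      ≡⟨ sumFin-+ at-start (λ v → at-middle v + at-end v) ⟩
    sumFin at-start + sumFin (λ v → at-middle v + at-end v)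
      ≡⟨ cong (sumFin at-start +_) (sumFin-+ at-middle at-end) ⟩
    sumFin at-start + (sumFin at-middle + sumFin at-end)
      ≡⟨ cong₂ _+_ (sumFin-point (start p) (α p))
                   (cong₂ _+_ (sumFin-point (middle p) (β p)) (sumFin-point (end p) (γ p))) ⟩
    α p + (β p + γ p) ∎
    where
    open ≡-Reasoning
    at-start at-middle at-end : Fin n → ℕ
    at-start  v = α p when ⌊ start p ≟ v ⌋
    at-middle v = β p when ⌊ middle p ≟ v ⌋
    at-end    v = γ p when ⌊ end p ≟ v ⌋

  covered : ∀ v → sum (map (occ {G = G} v) ps) ≡ 1
  covered v = trans (sym (occs≡sum v ps)) (factor v)
    where
    occs≡sum : ∀ v qs → occs {G = G} v qs ≡ sum (map (occ {G = G} v) qs)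
    occs≡sum v []       = refl
    occs≡sum v (q ∷ qs) = cong (occ {G = G} v q +_) (occs≡sum v qs)

  pathOf : ∀ v → ∃ λ p → p ∈ ps × v ∈ₚ p
  pathOf v = sum-map≡1-witness (covered v)

  same-path : ∀ {v p q} → p ∈ ps → q ∈ ps → v ∈ₚ p → v ∈ₚ q → p ≡ q
  same-path {v} = sum-map≡1-unique (covered v)

  start≢end : ∀ {p} → p ∈ ps → start p ≢ end p
  start≢end {p} p∈ps s≡e =
    2≰1 (≤-trans (twice s≡e)
        (≤-trans (term≤sum-map (occ {G = G} (start p)) p∈ps) (≤-reflexive (covered (start p)))))
    where
    twice : start p ≡ end p → 2 ≤ occ {G = G} (start p) p
    twice s≡e with start p ≟ start p | end p ≟ start p
    ... | yes _   | yes _   = s≤s (m≤n+m 1 (1 when ⌊ middle p ≟ start p ⌋))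
    ... | no s≢s | _       = ⊥-elim (s≢s refl)
    ... | _       | no e≢s = ⊥-elim (e≢s (sym s≡e))

  factorSum : (α β γ : Path → ℕ) → Fin n → ℕ
  factorSum α β γ v = sum (map (spread α β γ v) ps)

  factorSum-at : ∀ α β γ {v p} → p ∈ ps → v ∈ₚ p → factorSum α β γ v ≡ spread α β γ v p
  factorSum-at α β γ {v} = sum-map≡1-select (λ q → spread-outside α β γ q) (covered v)

  factorSum-start : ∀ α β γ {p} → p ∈ ps → factorSum α β γ (start p) ≡ α p
  factorSum-start α β γ {p} p∈ps
    rewrite factorSum-at α β γ p∈ps (start∈ₚ p) | ≟-refl (start p)
          | ≟-≢ (edge⇒≢ (edge-sym (start-edge p))) | ≟-≢ (≢-sym (start≢end p∈ps)) = +-identityʳ (α p)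

  factorSum-middle : ∀ α β γ {p} → p ∈ ps → factorSum α β γ (middle p) ≡ β p
  factorSum-middle α β γ {p} p∈ps
    rewrite factorSum-at α β γ p∈ps (middle∈ₚ p) | ≟-refl (middle p)
          | ≟-≢ (edge⇒≢ (start-edge p)) | ≟-≢ (edge⇒≢ (edge-sym (end-edge p))) = +-identityʳ (β p)

  factorSum-end : ∀ α β γ {p} → p ∈ ps → factorSum α β γ (end p) ≡ γ p
  factorSum-end α β γ {p} p∈ps
    rewrite factorSum-at α β γ p∈ps (end∈ₚ p) | ≟-refl (end p)
          | ≟-≢ (start≢end p∈ps) | ≟-≢ (edge⇒≢ (end-edge p)) = refl

  sumFin-factorSum : ∀ α β γ → sumFin (factorSum α β γ) ≡ sum (map (λ p → α p + (β p + γ p)) ps)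
  sumFin-factorSum α β γ = trans (sumFin-sum-map (spread α β γ) ps) (sum-map-cong ps (sumFin-spread α β γ))

  offStart offEnd offEdges : Path → ℕ
  offStart p = offTriangle (start p) (middle p)
  offEnd   p = offTriangle (middle p) (end p)
  offEdges p = offStart p + offEnd p

  offDegree charge : Fin n → ℕ
  offDegree = factorSum offStart offEdges offEnd
  charge    = factorSum (λ _ → 0) offEdges (λ _ → 0)

  Σoffdegree≡2Σcharge : sumFin offDegree ≡ sumFin charge + sumFin charge
  Σoffdegree≡2Σcharge = begin
    sumFin offDegree
      ≡⟨ sumFin-factorSum offStart offEdges offEnd ⟩
    sum (map (λ p → offStart p + (offEdges p + offEnd p)) ps)
      ≡⟨ sum-map-cong ps (λ p → regroup (offStart p) (offEnd p)) ⟩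
    sum (map (λ p → (0 + (offEdges p + 0)) + (0 + (offEdges p + 0))) ps)
      ≡⟨ sum-map-+ (λ p → 0 + (offEdges p + 0)) (λ p → 0 + (offEdges p + 0)) ps ⟩
    sum (map (λ p → 0 + (offEdges p + 0)) ps) + sum (map (λ p → 0 + (offEdges p + 0)) ps)
      ≡⟨ cong₂ _+_ Σcharge Σcharge ⟨
    sumFin charge + sumFin charge ∎
    where
    open ≡-Reasoning
    Σcharge : sumFin charge ≡ sum (map (λ p → 0 + (offEdges p + 0)) ps)
    Σcharge = sumFin-factorSum (λ _ → 0) offEdges (λ _ → 0)
    regroup : ∀ a c → a + ((a + c) + c) ≡ (0 + ((a + c) + 0)) + (0 + ((a + c) + 0))
    regroup = solve-∀

  charge-off-middle : ∀ {v p} → p ∈ ps → v ∈ₚ p → middle p ≢ v → charge v ≡ 0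
  charge-off-middle {v} {p} p∈ps v∈p m≢v
    rewrite factorSum-at (λ _ → 0) offEdges (λ _ → 0) p∈ps v∈p | ≟-≢ m≢v =
    cong₂ _+_ (0-when ⌊ start p ≟ v ⌋) (0-when ⌊ end p ≟ v ⌋)
    where
    0-when : ∀ b → 0 when b ≡ 0
    0-when true  = refl
    0-when false = refl

  edge⇒0<deg : ∀ {v x} → Edge v x → 0 < deg G v
  edge⇒0<deg vx = distinct-neighbours≤deg ([] ∷ []) (vx ∷ [])

  0<deg : ∀ v → 0 < deg G v
  0<deg v with pathOf v
  ... | p , _ , v∈p with ∈ₚ-cases p v∈p
  ...   | inj₁ refl        = edge⇒0<deg (start-edge p)
  ...   | inj₂ (inj₁ refl) = edge⇒0<deg (end-edge p)
  ...   | inj₂ (inj₂ refl) = edge⇒0<deg (edge-sym (end-edge p))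

  leaf-charges : ∀ {v} → deg G v ≡ 1 → offDegree v ≡ 1 × charge v ≡ 0
  leaf-charges {v} leaf with pathOf v
  ... | p , p∈ps , v∈p with ∈ₚ-cases p v∈p
  ...   | inj₁ refl =
    trans (factorSum-start offStart offEdges offEnd p∈ps) (leaf⇒offTriangle≡1 leaf (start-edge p)) ,
    factorSum-start (λ _ → 0) offEdges (λ _ → 0) p∈ps
  ...   | inj₂ (inj₁ refl) = ⊥-elim (2≰1 (subst (2 ≤_) leaf
    (distinct-neighbours≤deg ((start≢end p∈ps ∷ []) ∷ [] ∷ [])
                             (edge-sym (start-edge p) ∷ end-edge p ∷ []))))
  ...   | inj₂ (inj₂ refl) =
    trans (factorSum-end offStart offEdges offEnd p∈ps)
          (trans (offTriangle-sym (middle p) (end p)) (leaf⇒offTriangle≡1 leaf (edge-sym (end-edge p)))) ,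
    factorSum-end (λ _ → 0) offEdges (λ _ → 0) p∈ps

module Balance {n : ℕ} (G : Graph n)
  (deg≤3 : ∀ v → deg G v ≤ 3)
  (triangles : ∀ v → (deg G v ≡ 2) ⊎ (deg G v ≡ 3) → trianglesAt G v ≡ 1)
  (ps : List (Path3 G)) (factor : ∀ v → occs {G = G} v ps ≡ 1) where
  open Triangles G
  open Factor G ps factor

  one-triangle : ∀ {v} → 2 ≤ deg G v → trianglesAt G v ≡ 1
  one-triangle {v} 2≤d with deg G v | 2≤d | deg≤3 v | triangles v
  ... | 1 | s≤s () | _ | _
  ... | 2 | _ | _ | one = one (inj₁ refl)
  ... | 3 | _ | _ | one = one (inj₂ refl)
  ... | suc (suc (suc (suc _))) | _ | s≤s (s≤s (s≤s ())) | _

  triangle-at : ∀ {v} → 2 ≤ deg G v → ∃₂ (Triangle v)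
  triangle-at 2≤d = trianglesAt-positive (subst (0 <_) (sym (one-triangle 2≤d)) (s≤s z≤n))

  unique-at : ∀ {v u w} → Triangle v u w → UniqueTriangleAt v
  unique-at t = trianglesAt≡1⇒unique (one-triangle (triangle⇒2≤deg t))

  leaf-or-branching : ∀ v → deg G v ≡ 1 ⊎ 2 ≤ deg G v
  leaf-or-branching v with deg G v | 0<deg v
  ... | 1           | _ = inj₁ refl
  ... | suc (suc _) | _ = inj₂ (s≤s (s≤s z≤n))

  ¬4-neighbours : ∀ {v a b c d} → Unique (a ∷ b ∷ c ∷ d ∷ []) →
    ¬ All (Edge v) (a ∷ b ∷ c ∷ d ∷ [])
  ¬4-neighbours {v} distinct edges with ≤-trans (distinct-neighbours≤deg distinct edges) (deg≤3 v)
  ... | s≤s (s≤s (s≤s ()))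

  NeighbourCase : Fin n → Fin n → Fin n → Fin n → Set
  NeighbourCase v u w x = (x ≡ u ⊎ x ≡ w) × offTriangle v x ≡ 0 ⊎ x ≢ u × x ≢ w × offTriangle v x ≡ 1

  neighbour-cases : ∀ {v u w x} → Triangle v u w → Edge v x → NeighbourCase v u w x
  neighbour-cases {v} {u} {w} {x} t@(vu , vw , uw) vx with commonNeighbour? v x
  ... | yes (z , vz , xz) = inj₁ (unique-at t t (vx , vz , xz) , refl)
  ... | no ¬common        = inj₂ ( (λ { refl → ¬common (w , vw , uw) })
                                 , (λ { refl → ¬common (u , vu , edge-sym uw) })
                                 , refl)

  -- w cannot be the middle of its path (it would have four neighbours), so it is an endpoint
  -- whose path edge leaves the only triangle at w.
  corner-outside : ∀ {p w v y} → p ∈ ps → Triangle w v y → v ∈ₚ p → y ∈ₚ p → ¬ w ∈ₚ p →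
    charge w ≡ 0 × 0 < offDegree w
  corner-outside {p} {w} {v} {y} p∈ps t@(wv , wy , vy) v∈p y∈p w∉p with pathOf w
  ... | q , q∈ps , w∈q = by-position (∈ₚ-cases q w∈q)
    where
    apart : ∀ {z x} → z ∈ₚ q → x ∈ₚ p → z ≢ x
    apart z∈q x∈p refl with same-path p∈ps q∈ps x∈p z∈q
    ... | refl = w∉p w∈q

    off-edge : ∀ {x} → Edge w x → x ∈ₚ q → 0 < offTriangle w x
    off-edge wx x∈q with neighbour-cases t wx
    ... | inj₁ (inj₁ refl , _) = ⊥-elim (apart x∈q v∈p refl)
    ... | inj₁ (inj₂ refl , _) = ⊥-elim (apart x∈q y∈p refl)
    ... | inj₂ (_ , _ , off)   = subst (0 <_) (sym off) (s≤s z≤n)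

    by-position : start q ≡ w ⊎ middle q ≡ w ⊎ end q ≡ w → charge w ≡ 0 × 0 < offDegree w
    by-position (inj₁ refl) =
      charge-off-middle q∈ps w∈q (edge⇒≢ (edge-sym (start-edge q))) ,
      subst (0 <_) (sym (factorSum-start offStart offEdges offEnd q∈ps)) (off-edge (start-edge q) (middle∈ₚ q))
    by-position (inj₂ (inj₂ refl)) =
      charge-off-middle q∈ps w∈q (edge⇒≢ (end-edge q)) ,
      subst (0 <_) (sym (trans (factorSum-end offStart offEdges offEnd q∈ps) (offTriangle-sym (middle q) (end q))))
        (off-edge (edge-sym (end-edge q)) (middle∈ₚ q))
    by-position (inj₂ (inj₁ refl)) = ⊥-elim (¬4-neighbours
      ( (start≢end q∈ps ∷ apart (start∈ₚ q) v∈p ∷ apart (start∈ₚ q) y∈p ∷ [])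
      ∷ (apart (end∈ₚ q) v∈p ∷ apart (end∈ₚ q) y∈p ∷ [])
      ∷ (edge⇒≢ vy ∷ []) ∷ [] ∷ [])
      (edge-sym (start-edge q) ∷ end-edge q ∷ wv ∷ wy ∷ []))

  endpoint-charges : ∀ {p x y o} → p ∈ ps → Triangle (middle p) x y →
    (start p ≡ x × end p ≡ o ⊎ start p ≡ o × end p ≡ x) → o ≢ y →
    charge x ≡ 0 × charge y ≡ 0 × 0 < offDegree y
  endpoint-charges {p} {x} {y} {o} p∈ps t@(mx , my , xy) ends o≢y =
    charge-off-middle p∈ps (x∈p ends) (edge⇒≢ mx) ,
    corner-outside p∈ps (triangle-rotate (triangle-swap t)) (middle∈ₚ p) (x∈p ends) (y∉p ends)
    where
    x∈p : start p ≡ x × end p ≡ o ⊎ start p ≡ o × end p ≡ x → x ∈ₚ p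
    x∈p (inj₁ (refl , _)) = start∈ₚ p
    x∈p (inj₂ (_ , refl)) = end∈ₚ p

    y∉p : start p ≡ x × end p ≡ o ⊎ start p ≡ o × end p ≡ x → ¬ y ∈ₚ p
    y∉p ends y∈p with ∈ₚ-cases p y∈p | ends
    ... | inj₁ refl        | inj₁ (refl , _) = edge⇒≢ xy refl
    ... | inj₁ refl        | inj₂ (refl , _) = o≢y refl
    ... | inj₂ (inj₁ m≡y) | _                = edge⇒≢ my m≡y
    ... | inj₂ (inj₂ refl) | inj₁ (_ , refl) = o≢y refl
    ... | inj₂ (inj₂ refl) | inj₂ (_ , refl) = edge⇒≢ xy refl

  Compensating : Fin n → Fin n → Set
  Compensating u w = charge u ≡ 0 × charge w ≡ 0 × (0 < offDegree u ⊎ 0 < offDegree w)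

  -- A charged v is the middle of its path. Two off-triangle path edges would give v four
  -- neighbours, so exactly one path edge is off-triangle and the other leads to a corner.
  charged-vertex : ∀ {v u w} → Triangle v u w → 0 < charge v →
    charge v ≡ 1 × offDegree v ≡ 1 × Compensating u w
  charged-vertex {v} {u} {w} t charged with pathOf v
  ... | p , p∈ps , v∈p with ∈ₚ-cases p v∈p
  ...   | inj₁ refl =
    ⊥-elim (n>0⇒n≢0 charged (charge-off-middle p∈ps v∈p (edge⇒≢ (edge-sym (start-edge p)))))
  ...   | inj₂ (inj₂ refl) =
    ⊥-elim (n>0⇒n≢0 charged (charge-off-middle p∈ps v∈p (edge⇒≢ (end-edge p))))
  ...   | inj₂ (inj₁ refl) =
    by-ends (neighbour-cases t (edge-sym (start-edge p))) (neighbour-cases t (end-edge p))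
    where
    s e : Fin n
    s = start p
    e = end p

    offEdges≡ : ∀ {a b} → offTriangle v s ≡ a → offTriangle v e ≡ b → offEdges p ≡ a + b
    offEdges≡ s≡a e≡b = cong₂ _+_ (trans (offTriangle-sym s v) s≡a) e≡b

    middle-values : ∀ {a b} → offTriangle v s ≡ a → offTriangle v e ≡ b →
      charge v ≡ a + b × offDegree v ≡ a + b
    middle-values s≡a e≡b =
      trans (factorSum-middle (λ _ → 0) offEdges (λ _ → 0) p∈ps) (offEdges≡ s≡a e≡b) ,
      trans (factorSum-middle offStart offEdges offEnd p∈ps) (offEdges≡ s≡a e≡b)

    other-end : ∀ {x o} → (s ≡ x × e ≡ o ⊎ s ≡ o × e ≡ x) → x ≡ u ⊎ x ≡ w → o ≢ u → o ≢ w →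
      Compensating u w
    other-end ends (inj₁ refl) o≢u o≢w with endpoint-charges p∈ps t ends o≢w
    ... | cu , cw , dw = cu , cw , inj₂ dw
    other-end ends (inj₂ refl) o≢u o≢w with endpoint-charges p∈ps (triangle-swap t) ends o≢u
    ... | cw , cu , du = cu , cw , inj₁ du

    by-ends : NeighbourCase v u w s → NeighbourCase v u w e → charge v ≡ 1 × offDegree v ≡ 1 × Compensating u w
    by-ends (inj₁ (_ , s0)) (inj₁ (_ , e0)) = ⊥-elim (n>0⇒n≢0 charged (proj₁ (middle-values s0 e0)))
    by-ends (inj₂ (s≢u , s≢w , _)) (inj₂ (e≢u , e≢w , _)) = ⊥-elim (¬4-neighbours
      ( (start≢end p∈ps ∷ s≢u ∷ s≢w ∷ [])
      ∷ (e≢u ∷ e≢w ∷ [])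
      ∷ (edge⇒≢ (proj₂ (proj₂ t)) ∷ []) ∷ [] ∷ [])
      (edge-sym (start-edge p) ∷ end-edge p ∷ proj₁ t ∷ proj₁ (proj₂ t) ∷ []))
    by-ends (inj₂ (s≢u , s≢w , s1)) (inj₁ (e∈uw , e0)) =
      let (cv , dv) = middle-values s1 e0 in cv , dv , other-end (inj₂ (refl , refl)) e∈uw s≢u s≢w
    by-ends (inj₁ (s∈uw , s0)) (inj₂ (e≢u , e≢w , e1)) =
      let (cv , dv) = middle-values s0 e1 in cv , dv , other-end (inj₁ (refl , refl)) s∈uw e≢u e≢w

  Σ₃ : (Fin n → ℕ) → Fin n → Fin n → Fin n → ℕ
  Σ₃ f v u w = f v + (f u + f w)

  Balanced : Fin n → Fin n → Fin n → Set
  Balanced v u w = Σ₃ charge v u w + Σ₃ charge v u w ≤ Σ₃ offDegree v u w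

  balanced-rotate : ∀ {v u w} → Balanced u v w → Balanced v u w
  balanced-rotate {v} {u} {w} = subst₂ (λ c d → c + c ≤ d)
    (x∙yz≈y∙xz +-commutativeSemigroup (charge u) (charge v) (charge w))
    (x∙yz≈y∙xz +-commutativeSemigroup (offDegree u) (offDegree v) (offDegree w))

  balanced-swap : ∀ {v u w} → Balanced v u w → Balanced v w u
  balanced-swap {v} {u} {w} = subst₂ (λ c d → c + c ≤ d)
    (cong (charge v +_) (+-comm (charge u) (charge w)))
    (cong (offDegree v +_) (+-comm (offDegree u) (offDegree w)))

  charged⇒balanced : ∀ {v u w} → Triangle v u w → 0 < charge v → Balanced v u w
  charged⇒balanced t charged with charged-vertex t charged
  ... | cv , dv , cu , cw , du⊎dw rewrite cv | dv | cu | cw = s≤s (positive-sum du⊎dw)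
    where
    positive-sum : ∀ {a b} → 0 < a ⊎ 0 < b → 0 < a + b
    positive-sum {a} {b} (inj₁ a>0) = ≤-trans a>0 (m≤m+n a b)
    positive-sum {a} {b} (inj₂ b>0) = ≤-trans b>0 (m≤n+m b a)

  triangle-balanced : ∀ {v u w} → Triangle v u w → Balanced v u w
  triangle-balanced {v} {u} {w} t with charge v ℕ.≟ 0 | charge u ℕ.≟ 0 | charge w ℕ.≟ 0
  ... | no cv≢0 | _       | _       = charged⇒balanced t (n≢0⇒n>0 cv≢0)
  ... | yes _   | no cu≢0 | _       = balanced-rotate (charged⇒balanced (triangle-rotate t) (n≢0⇒n>0 cu≢0))
  ... | yes _   | yes _   | no cw≢0 =
    balanced-swap (balanced-rotate (charged⇒balanced (triangle-rotate (triangle-swap t)) (n≢0⇒n>0 cw≢0)))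
  ... | yes cv  | yes cu  | yes cw rewrite cv | cu | cw = z≤n

  -- For v of degree at least 2, around f v is the sum of f over the triangle at v; summing over
  -- all v therefore counts every triangle once from each corner.
  around : (Fin n → ℕ) → Fin n → ℕ
  around f v = f v + sumFin (λ x → f x when mate v x)

  around-balanced : ∀ v → around charge v + around charge v ≤ around offDegree v
  around-balanced v with leaf-or-branching v
  ... | inj₁ leaf rewrite proj₂ (leaf-charges leaf) | sumFin-none charge (λ x → leaf⇒¬mate x leaf) = z≤n
  ... | inj₂ 2≤d with triangle-at 2≤d
  ...   | u , w , t rewrite mates-of-triangle (unique-at t) t charge | mates-of-triangle (unique-at t) t offDegree =
    triangle-balanced t

  mates-of-leaf : ∀ {x} → deg G x ≡ 1 → ∀ k → sumFin (λ v → k when mate v x) ≡ 0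
  mates-of-leaf {x} leaf k = sumFin-none (λ _ → k) (λ v → trans (mate-sym v x) (leaf⇒¬mate v leaf))

  mates-of-branching : ∀ {x} → 2 ≤ deg G x → ∀ k → sumFin (λ v → k when mate v x) ≡ k + k
  mates-of-branching {x} 2≤d k with triangle-at 2≤d
  ... | u , w , t =
    trans (sumFin-cong (λ v → cong (k when_) (mate-sym v x))) (mates-of-triangle (unique-at t) t (λ _ → k))

  charge-mates : ∀ x → sumFin (λ v → charge x when mate v x) ≡ charge x + charge x
  charge-mates x with leaf-or-branching x
  ... | inj₁ leaf rewrite proj₂ (leaf-charges leaf) = mates-of-leaf leaf 0
  ... | inj₂ 2≤d = mates-of-branching 2≤d (charge x)

  isLeaf : Fin n → Bool
  isLeaf x = isOne (deg G x)

  branching⇒¬leaf : ∀ {x} → 2 ≤ deg G x → isLeaf x ≡ false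
  branching⇒¬leaf {x} 2≤d with deg G x | 2≤d
  ... | suc (suc _) | _         = refl
  ... | 1           | s≤s ()

  offDegree-mates : ∀ x →
    sumFin (λ v → offDegree x when mate v x) + (1 when isLeaf x + 1 when isLeaf x) ≡ offDegree x + offDegree x
  offDegree-mates x with leaf-or-branching x
  ... | inj₁ leaf rewrite leaf | mates-of-leaf leaf (offDegree x) | proj₁ (leaf-charges leaf) = refl
  ... | inj₂ 2≤d rewrite mates-of-branching 2≤d (offDegree x) | branching⇒¬leaf 2≤d =
    +-identityʳ (offDegree x + offDegree x)

  sumFin-around : ∀ f → sumFin (around f) ≡ sumFin f + sumFin (λ x → sumFin (λ v → f x when mate v x))
  sumFin-around f = trans (sumFin-+ f (λ v → sumFin (λ x → f x when mate v x)))
    (cong (sumFin f +_) (sumFin-swap (λ v x → f x when mate v x)))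

  no-leaves : count isLeaf ≡ 0
  no-leaves = leaf-count-arith m s (count isLeaf) leaves balance
    where
    open ≡-Reasoning
    m s : ℕ
    m = sumFin charge
    s = sumFin (λ x → sumFin (λ v → offDegree x when mate v x))
    leaves : s + (count isLeaf + count isLeaf) ≡ (m + m) + (m + m)
    leaves = begin
      s + (count isLeaf + count isLeaf)
        ≡⟨ cong (λ l → s + (l + l)) (count≡sumFin isLeaf) ⟩
      s + (sumFin (λ x → 1 when isLeaf x) + sumFin (λ x → 1 when isLeaf x))
        ≡⟨ cong (s +_) (sumFin-+ (λ x → 1 when isLeaf x) (λ x → 1 when isLeaf x)) ⟨
      s + sumFin (λ x → 1 when isLeaf x + 1 when isLeaf x)
        ≡⟨ sumFin-+ (λ x → sumFin (λ v → offDegree x when mate v x))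
                    (λ x → 1 when isLeaf x + 1 when isLeaf x) ⟨
      sumFin (λ x → sumFin (λ v → offDegree x when mate v x) + (1 when isLeaf x + 1 when isLeaf x))
        ≡⟨ sumFin-cong offDegree-mates ⟩
      sumFin (λ x → offDegree x + offDegree x)
        ≡⟨ sumFin-+ offDegree offDegree ⟩
      sumFin offDegree + sumFin offDegree
        ≡⟨ cong₂ _+_ Σoffdegree≡2Σcharge Σoffdegree≡2Σcharge ⟩
      (m + m) + (m + m) ∎
    Σaround-charge : sumFin (around charge) ≡ m + (m + m)
    Σaround-charge =
      trans (sumFin-around charge) (cong (m +_) (trans (sumFin-cong charge-mates) (sumFin-+ charge charge)))
    balance : (m + (m + m)) + (m + (m + m)) ≤ (m + m) + s
    balance = subst₂ _≤_
      (trans (sumFin-+ (around charge) (around charge)) (cong₂ _+_ Σaround-charge Σaround-charge))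
      (trans (sumFin-around offDegree) (cong (_+ s) Σoffdegree≡2Σcharge))
      (sumFin-mono around-balanced)

-- Neither connectivity nor the exact number of leaves matters: one vertex of degree 1 already
-- rules out a Λ-factor.
mainTheorem9 : ∀ (n : ℕ) (A : Graph n)
    → Connected A
    → (∀ v → deg A v ≤ 3)
    → (∀ v → (deg A v ≡ 2) ⊎ (deg A v ≡ 3) → trianglesAt A v ≡ 1)
    → count (λ v → isOne (deg A v)) ≡ 3
    → ¬ HasΛFactor A
mainTheorem9 n A _ deg≤3 triangles three-leaves (ps , factor) =
  1+n≢0 (trans (sym three-leaves) (Balance.no-leaves A deg≤3 triangles ps factor))
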